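{- For any monoid $M$, the clone $\mathsf{WInc}(M):=\mathbf{P}(M)/_{\equiv_{\mathrm{sort}}}$ admits the presentation $(\mathcal{G}_M,\mathcal{R}'_M)$, where $\mathcal{R}'_M$ is the equivalence relation on $\mathbf{T}(\mathcal{G}_M)$ generated by $\mathcal{R}_M$ together with the equation $\mathrm{rc}_M(1^e2^e)\sim\mathrm{rc}_M(2^e1^e)$ (in arity $2$), where $e$ is the unit of $M$.
   Context: Clones: a clone $C$ is a graded set with superposition maps $C(n)\times C(m)^n\to C(m)$, $x[y_1,\dots,y_n]$, and projections $\mathbf{1}_{i,n}$ satisfying $\mathbf{1}_{i,n}[y_1,\dots,y_n]=y_i$, $x[\mathbf{1}_{1,n},\dots,\mathbf{1}_{n,n}]=x$ and $x[y_1,\dots,y_n][z_1,\dots,z_m]=x[y_1[z_1,\dots,z_m],\dots,y_n[z_1,\dots,z_m]]$; clone congruences are arity-preserving equivalence relations compatible with superposition. Let $(M,\cdot,e)$ be a monoid. $M$-pigmented letters are pairs $i^\alpha$ ($i\ge1$, $\alpha\in M$); $\mathbf{P}(M)(n)$ is the set of words of such letters with values in $[n]$. With $\alpha\odot i_1^{\alpha_1}\cdots i_\ell^{\alpha_\ell}:=i_1^{\alpha\alpha_1}\cdots i_\ell^{\alpha\alpha_\ell}$, $\mathbf{P}(M)$ is the clone with $i_1^{\alpha_1}\cdots i_\ell^{\alpha_\ell}[\mathfrak{p}_1,\dots,\mathfrak{p}_n]:=(\alpha_1\odot\mathfrak{p}_{i_1})\cdots(\alpha_\ell\odot\mathfrak{p}_{i_\ell})$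 and projections $i^e$. $\equiv_{\mathrm{sort}}$ relates two words of the same arity iff one is a rearrangement of the letters of the other; it is a clone congruence. Terms: $\mathbf{T}(\mathcal{G})(n)$ is the set of $\mathcal{G}$-terms with variables among $x_1,\dots,x_n$ (free clone: superposition = substitution, projections $x_i$). For $(\mathcal{G},\mathcal{R})$, $\equiv_{\mathcal{R}}$ is the smallest clone congruence containing $\mathcal{R}$; $(\mathcal{G},\mathcal{R})$ is a presentation of $C$ if $C\cong\mathbf{T}(\mathcal{G})/_{\equiv_{\mathcal{R}}}$. $\mathcal{G}_M(0)=\{\mathsf{u}\}$, $\mathcal{G}_M(1)=\{\mathsf{p}_\alpha:\alpha\in M\}$, $\mathcal{G}_M(2)=\{\star\}$; $\mathcal{R}_M$ is generated by $\star[\star[x_1,x_2],x_3]\sim\star[x_1,\star[x_2,x_3]]$, $\star[\mathsf{u},x_1]\sim x_1\sim\star[x_1,\mathsf{u}]$, $\mathsf{p}_\alpha[\star[x_1,x_2]]\sim\star[\mathsf{p}_\alpha[x_1],\mathsf{p}_\alpha[x_2]]$, $\mathsf{p}_\alpha[\mathsf{u}]\sim\mathsf{u}$, $\mathsf{p}_{\alpha_1}[\mathsf{p}_{\alpha_2}[x_1]]\sim\mathsf{p}_{\alpha_1\alpha_2}[x_1]$, $\mathsf{p}_e[x_1]\sim x_1$. Right comb map: $\mathrm{rc}_M(\epsilon)=\mathsf{u}$, $\mathrm{rc}_M(i^\alpha\mathfrak{p}')=\star[\mathsf{p}_\alpha[x_i],\mathrm{rc}_M(\mathfrak{p}')]$.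 -}

module Defs where

open import Level using (Level)
open import Data.Nat using (ℕ)
open import Data.Fin using (Fin; zero; suc)
open import Data.Product using (Σ; _×_; _,_)
open import Data.List using (List; []; _∷_; map; concatMap)
open import Data.List.Relation.Binary.Permutation.Propositional using (_↭_)
open import Relation.Binary.PropositionalEquality using (_≡_)
open import Algebra.Structures using (IsMonoid)

-- Everything is parametrised by a monoid (A, _∙_, e); the monoid laws are
-- supplied separately as IsMonoid _≡_ _∙_ e in the statement.
module WInc {ℓ : Level} {A : Set ℓ} (_∙_ : A → A → A) (e : A) where

  -- The clone P(M) of M-pigmented words (letters i^α with i ∈ [n],
  -- represented 0-based as Fin n).

  Letter : ℕ → Set ℓ
  Letter n = Fin n × A

  Word : ℕ → Set ℓ
  Word n = List (Letter n)

  _⊙_ : ∀ {m} → A → Word m → Word m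
  α ⊙ w = map (λ { (j , β) → (j , α ∙ β) }) w

  _⟪_⟫ : ∀ {n m} → Word n → (Fin n → Word m) → Word m
  w ⟪ ps ⟫ = concatMap (λ { (i , α) → α ⊙ ps i }) w

  projP : ∀ {n} → Fin n → Word n
  projP i = (i , e) ∷ []

  _≡sort_ : ∀ {n} → Word n → Word n → Set ℓ
  w ≡sort w' = w ↭ w'

  -- The free clone T(G_M): G_M(0) = {u}, G_M(1) = {p_α}, G_M(2) = {⋆}.

  data Term (n : ℕ) : Set ℓ where
    var  : Fin n → Term n
    u    : Term n
    p    : A → Term n → Term n
    star : Term n → Term n → Term n

  _[_] : ∀ {n m} → Term n → (Fin n → Term m) → Term m
  var i    [ σ ] = σ i
  u        [ σ ] = u
  p α t    [ σ ] = p α (t [ σ ])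
  star s t [ σ ] = star (s [ σ ]) (t [ σ ])

  rc : ∀ {n} → Word n → Term n
  rc []             = u
  rc ((i , α) ∷ w)  = star (p α (var i)) (rc w)

  private
    x₁ : ∀ {n} → Term (Data.Nat.suc n)
    x₁ = var zero
    x₂ : ∀ {n} → Term (Data.Nat.suc (Data.Nat.suc n))
    x₂ = var (suc zero)
    x₃ : ∀ {n} → Term (Data.Nat.suc (Data.Nat.suc (Data.Nat.suc n)))
    x₃ = var (suc (suc zero))

  data R' : (n : ℕ) → Term n → Term n → Set ℓ where
    assoc  : R' 3 (star (star x₁ x₂) x₃) (star x₁ (star x₂ x₃))
    unitˡ  : R' 1 (star u x₁) x₁
    unitʳ  : R' 1 x₁ (star x₁ u)
    pstar  : ∀ α → R' 2 (p α (star x₁ x₂)) (star (p α x₁) (p α x₂))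
    pu     : ∀ α → R' 0 (p α u) u
    pp     : ∀ α₁ α₂ → R' 1 (p α₁ (p α₂ x₁)) (p (α₁ ∙ α₂) x₁)
    pe     : R' 1 (p e x₁) x₁
    comm   : R' 2 (rc ((zero , e) ∷ (suc zero , e) ∷ []))
                  (rc ((suc zero , e) ∷ (zero , e) ∷ []))

  data _≈R_ : ∀ {n} → Term n → Term n → Set ℓ where
    base  : ∀ {n} {s t : Term n} → R' n s t → s ≈R t
    refl  : ∀ {n} {s : Term n} → s ≈R s
    sym   : ∀ {n} {s t : Term n} → s ≈R t → t ≈R s
    trans : ∀ {n} {s t r : Term n} → s ≈R t → t ≈R r → s ≈R r
    comp  : ∀ {n m} {s s' : Term n} {σ σ' : Fin n → Term m} →
            s ≈R s' → (∀ i → σ i ≈R σ' i) → (s [ σ ]) ≈R (s' [ σ' ])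

  -- (G_M, R'_M) is a presentation of WInc(M) = P(M)/≡sort:
  -- there is an arity-preserving map φ : T(G_M) → P(M) inducing a clone
  -- isomorphism T(G_M)/≡_{R'} ≅ P(M)/≡sort, i.e. φ is well defined and
  -- injective on classes, surjective onto classes, and commutes with
  -- superposition and projections up to ≡sort.

  IsPresentationOfWInc : Set ℓ
  IsPresentationOfWInc =
    Σ (∀ {n} → Term n → Word n) λ φ →
      (∀ {n} {s t : Term n} → s ≈R t → φ s ≡sort φ t)
    × (∀ {n} {s t : Term n} → φ s ≡sort φ t → s ≈R t)
    × (∀ {n} (w : Word n) → Σ (Term n) λ t → φ t ≡sort w)
    × (∀ {n m} (t : Term n) (σ : Fin n → Term m) →
         φ (t [ σ ]) ≡sort (φ t ⟪ (λ i → φ (σ i)) ⟫))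
    × (∀ {n} (i : Fin n) → φ (var i) ≡sort projP i)

{-# OPTIONS --safe #-}
-- Interpret a term as the word read off its leaves: a variable xᵢ becomes i^e,
-- u the empty word, p_α multiplies every pigment on the left by α, and ⋆ is
-- concatenation.  This map is a clone morphism, and every generating equation
-- of R'_M holds up to rearrangement, so it descends to T(G_M)/≡_{R'} → WInc(M).
-- Conversely the equations of R_M rewrite every term t into the right comb
-- rc(⟦ t ⟧) of its word, and the extra equation, instantiated, makes ⋆
-- commutative, so right combs of rearranged words are identified; since
-- ⟦ rc(w) ⟧ = w, the induced map is bijective.
module Submission where

open import Defs
open import Level using (Level)
open import Relation.Binary.PropositionalEquality using (_≡_)
open import Algebra.Structures using (IsMonoid)
open import Data.Nat using (ℕ)
open import Data.Fin using (Fin; zero; suc)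
open import Data.Product using (_,_)
open import Data.List using (List; []; _∷_; _++_; concatMap)
open import Data.List.Properties using (map-++; map-∘; map-cong; map-id; concatMap-++; ++-identityʳ)
open import Data.List.Relation.Binary.Permutation.Propositional as ↭
  using (_↭_; prep; swap; ↭-reflexive; ↭-sym; ↭-trans)
open import Data.List.Relation.Binary.Permutation.Propositional.Properties
  using (++⁺ˡ; ++⁺; shifts; map⁺)
open import Relation.Binary.Bundles using (Setoid)
import Relation.Binary.PropositionalEquality as ≡
import Relation.Binary.Reasoning.Setoid as SetoidReasoning

module _ {a b} {A : Set a} {B : Set b} where

  concatMap-↭ : ∀ (f : A → List B) {xs ys} → xs ↭ ys → concatMap f xs ↭ concatMap f ys
  concatMap-↭ f ↭.refl        = ↭.refl
  concatMap-↭ f (prep x p)    = ++⁺ˡ (f x) (concatMap-↭ f p)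
  concatMap-↭ f (swap x y p)  =
    ↭-trans (++⁺ˡ (f x) (++⁺ˡ (f y) (concatMap-↭ f p))) (shifts (f x) (f y))
  concatMap-↭ f (↭.trans p q) = ↭-trans (concatMap-↭ f p) (concatMap-↭ f q)

  concatMap-cong-↭ : ∀ {f g : A → List B} → (∀ x → f x ↭ g x) →
                     ∀ xs → concatMap f xs ↭ concatMap g xs
  concatMap-cong-↭ f↭g []       = ↭.refl
  concatMap-cong-↭ f↭g (x ∷ xs) = ++⁺ (f↭g x) (concatMap-cong-↭ f↭g xs)

module Presentation {ℓ : Level} {A : Set ℓ} (_∙_ : A → A → A) (e : A)
                    (isMonoid : IsMonoid _≡_ _∙_ e) where
  open WInc _∙_ e
  open IsMonoid isMonoid using (identityˡ; identityʳ) renaming (assoc to ∙-assoc)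

  ⊙-++ : ∀ {m} α (v w : Word m) → α ⊙ (v ++ w) ≡ α ⊙ v ++ α ⊙ w
  ⊙-++ α = map-++ _

  ⊙-⊙ : ∀ {m} α β (w : Word m) → α ⊙ (β ⊙ w) ≡ (α ∙ β) ⊙ w
  ⊙-⊙ α β w = ≡.trans (≡.sym (map-∘ w))
                      (map-cong (λ { (j , γ) → ≡.cong (j ,_) (≡.sym (∙-assoc α β γ)) }) w)

  e⊙ : ∀ {m} (w : Word m) → e ⊙ w ≡ w
  e⊙ w = ≡.trans (map-cong (λ { (j , γ) → ≡.cong (j ,_) (identityˡ γ) }) w) (map-id w)

  ⟪⟫-++ : ∀ {n m} (v w : Word n) (ps : Fin n → Word m) →
          (v ++ w) ⟪ ps ⟫ ≡ v ⟪ ps ⟫ ++ w ⟪ ps ⟫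
  ⟪⟫-++ v w ps = concatMap-++ _ v w

  ⊙-⟪⟫ : ∀ {n m} α (w : Word n) (ps : Fin n → Word m) →
         α ⊙ (w ⟪ ps ⟫) ≡ (α ⊙ w) ⟪ ps ⟫
  ⊙-⟪⟫ α []            ps = ≡.refl
  ⊙-⟪⟫ α ((i , β) ∷ w) ps =
    ≡.trans (⊙-++ α (β ⊙ ps i) (w ⟪ ps ⟫))
            (≡.cong₂ _++_ (⊙-⊙ α β (ps i)) (⊙-⟪⟫ α w ps))

  ⟪⟫-↭ : ∀ {n m} {v w : Word n} {ps qs : Fin n → Word m} →
         v ↭ w → (∀ i → ps i ↭ qs i) → v ⟪ ps ⟫ ↭ w ⟪ qs ⟫
  ⟪⟫-↭ {w = w} v↭w ps↭qs =
    ↭-trans (concatMap-↭ _ v↭w)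
            (concatMap-cong-↭ (λ { (i , β) → map⁺ _ (ps↭qs i) }) w)

  ⟦_⟧ : ∀ {n} → Term n → Word n
  ⟦ var i ⟧    = projP i
  ⟦ u ⟧        = []
  ⟦ p α t ⟧    = α ⊙ ⟦ t ⟧
  ⟦ star s t ⟧ = ⟦ s ⟧ ++ ⟦ t ⟧

  ⟦⟧-[] : ∀ {n m} (t : Term n) (σ : Fin n → Term m) →
          ⟦ t [ σ ] ⟧ ≡ ⟦ t ⟧ ⟪ (λ i → ⟦ σ i ⟧) ⟫
  ⟦⟧-[] (var i)    σ = ≡.sym (≡.trans (++-identityʳ _) (e⊙ ⟦ σ i ⟧))
  ⟦⟧-[] u          σ = ≡.refl
  ⟦⟧-[] (p α t)    σ = ≡.trans (≡.cong (α ⊙_) (⟦⟧-[] t σ)) (⊙-⟪⟫ α ⟦ t ⟧ _)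
  ⟦⟧-[] (star s t) σ =
    ≡.trans (≡.cong₂ _++_ (⟦⟧-[] s σ) (⟦⟧-[] t σ)) (≡.sym (⟪⟫-++ ⟦ s ⟧ ⟦ t ⟧ _))

  ⟦⟧-R' : ∀ {n} {s t : Term n} → R' n s t → ⟦ s ⟧ ↭ ⟦ t ⟧
  ⟦⟧-R' assoc       = ↭.refl
  ⟦⟧-R' unitˡ       = ↭.refl
  ⟦⟧-R' unitʳ       = ↭.refl
  ⟦⟧-R' (pstar α)   = ↭.refl
  ⟦⟧-R' (pu α)      = ↭.refl
  ⟦⟧-R' (pp α₁ α₂)  = ↭-reflexive (≡.cong (λ γ → (zero , γ) ∷ []) (≡.sym (∙-assoc α₁ α₂ e)))
  ⟦⟧-R' pe          = ↭-reflexive (≡.cong (λ γ → (zero , γ) ∷ []) (identityˡ e))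
  ⟦⟧-R' comm        = swap _ _ ↭.refl

  ⟦⟧-sound : ∀ {n} {s t : Term n} → s ≈R t → ⟦ s ⟧ ↭ ⟦ t ⟧
  ⟦⟧-sound (base r)      = ⟦⟧-R' r
  ⟦⟧-sound refl          = ↭.refl
  ⟦⟧-sound (sym h)       = ↭-sym (⟦⟧-sound h)
  ⟦⟧-sound (trans h h′)  = ↭-trans (⟦⟧-sound h) (⟦⟧-sound h′)
  ⟦⟧-sound (comp {s = s} {s′} {σ} {σ′} h hσ) =
    ↭-trans (↭-reflexive (⟦⟧-[] s σ))
      (↭-trans (⟪⟫-↭ (⟦⟧-sound h) (λ i → ⟦⟧-sound (hσ i)))
               (↭-reflexive (≡.sym (⟦⟧-[] s′ σ′))))

  ⟦rc⟧ : ∀ {m} (w : Word m) → ⟦ rc w ⟧ ≡ w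
  ⟦rc⟧ []            = ≡.refl
  ⟦rc⟧ ((i , α) ∷ w) = ≡.cong₂ _∷_ (≡.cong (i ,_) (identityʳ α)) (⟦rc⟧ w)

  ≈R-setoid : ℕ → Setoid ℓ ℓ
  ≈R-setoid n = record
    { Carrier       = Term n
    ; _≈_           = _≈R_
    ; isEquivalence = record { refl = refl ; sym = sym ; trans = trans }
    }

  σ₂ : ∀ {m} → Term m → Term m → Fin 2 → Term m
  σ₂ s t zero       = s
  σ₂ s t (suc zero) = t

  σ₃ : ∀ {m} → Term m → Term m → Term m → Fin 3 → Term m
  σ₃ s t r zero             = s
  σ₃ s t r (suc zero)       = t
  σ₃ s t r (suc (suc zero)) = r

  R'-instance : ∀ {n m} {s t : Term n} → R' n s t → (σ : Fin n → Term m) →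
                (s [ σ ]) ≈R (t [ σ ])
  R'-instance r σ = comp (base r) (λ _ → refl)

  star-cong : ∀ {m} {s s′ t t′ : Term m} → s ≈R s′ → t ≈R t′ → star s t ≈R star s′ t′
  star-cong {s = s} {s′} {t} {t′} s≈s′ t≈t′ =
    comp {s = star (var zero) (var (suc zero))} {σ = σ₂ s t} {σ' = σ₂ s′ t′} refl
         (λ { zero → s≈s′ ; (suc zero) → t≈t′ })

  p-cong : ∀ {m} α {t t′ : Term m} → t ≈R t′ → p α t ≈R p α t′
  p-cong α {t} {t′} t≈t′ =
    comp {n = 1} {s = p α (var zero)} {σ = λ _ → t} {σ' = λ _ → t′} refl (λ _ → t≈t′)

  p-rc : ∀ {m} α (w : Word m) → p α (rc w) ≈R rc (α ⊙ w)
  p-rc α []            = R'-instance (pu α) (λ ())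
  p-rc α ((i , β) ∷ w) =
    trans (R'-instance (pstar α) (σ₂ (p β (var i)) (rc w)))
          (star-cong (R'-instance (pp α β) (λ _ → var i)) (p-rc α w))

  star-rc : ∀ {m} (v w : Word m) → star (rc v) (rc w) ≈R rc (v ++ w)
  star-rc []            w = R'-instance unitˡ (λ _ → rc w)
  star-rc ((i , β) ∷ v) w =
    trans (R'-instance assoc (σ₃ (p β (var i)) (rc v) (rc w)))
          (star-cong refl (star-rc v w))

  ≈R-rc-⟦⟧ : ∀ {m} (t : Term m) → t ≈R rc ⟦ t ⟧
  ≈R-rc-⟦⟧ (var i)    = trans (R'-instance unitʳ (λ _ → var i))
                              (star-cong (sym (R'-instance pe (λ _ → var i))) refl)
  ≈R-rc-⟦⟧ u          = refl
  ≈R-rc-⟦⟧ (p α t)    = trans (p-cong α (≈R-rc-⟦⟧ t)) (p-rc α ⟦ t ⟧)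
  ≈R-rc-⟦⟧ (star s t) = trans (star-cong (≈R-rc-⟦⟧ s) (≈R-rc-⟦⟧ t)) (star-rc ⟦ s ⟧ ⟦ t ⟧)

  star-comm : ∀ {m} (s t : Term m) → star s t ≈R star t s
  star-comm s t = comp {σ = σ₂ s t} star-comm-vars (λ _ → refl)
    where
    star-comm-vars : star {2} (var zero) (var (suc zero)) ≈R star (var (suc zero)) (var zero)
    star-comm-vars = trans (≈R-rc-⟦⟧ _) (trans (base comm) (sym (≈R-rc-⟦⟧ _)))

  rc-↭ : ∀ {m} {v w : Word m} → v ↭ w → rc v ≈R rc w
  rc-↭ ↭.refl            = refl
  rc-↭ (prep x v↭w)      = star-cong refl (rc-↭ v↭w)
  rc-↭ {m} (swap {v} {w} (i , α) (j , β) v↭w) = begin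
    star a (star b (rc v))  ≈⟨ sym (R'-instance assoc (σ₃ a b (rc v))) ⟩
    star (star a b) (rc v)  ≈⟨ star-cong (star-comm a b) (rc-↭ v↭w) ⟩
    star (star b a) (rc w)  ≈⟨ R'-instance assoc (σ₃ b a (rc w)) ⟩
    star b (star a (rc w))  ∎
    where
    open SetoidReasoning (≈R-setoid m)
    a b : Term m
    a = p α (var i)
    b = p β (var j)
  rc-↭ (↭.trans u↭v v↭w) = trans (rc-↭ u↭v) (rc-↭ v↭w)

  ⟦⟧-complete : ∀ {n} {s t : Term n} → ⟦ s ⟧ ↭ ⟦ t ⟧ → s ≈R t
  ⟦⟧-complete {s = s} {t} ⟦s⟧↭⟦t⟧ =
    trans (≈R-rc-⟦⟧ s) (trans (rc-↭ ⟦s⟧↭⟦t⟧) (sym (≈R-rc-⟦⟧ t)))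

  isPresentation : IsPresentationOfWInc
  isPresentation =
      ⟦_⟧
    , ⟦⟧-sound
    , ⟦⟧-complete
    , (λ w → rc w , ↭-reflexive (⟦rc⟧ w))
    , (λ t σ → ↭-reflexive (⟦⟧-[] t σ))
    , (λ i → ↭.refl)

proposition4p3p1 : ∀ {ℓ : Level} {A : Set ℓ} (_∙_ : A → A → A) (e : A) →
    IsMonoid _≡_ _∙_ e → WInc.IsPresentationOfWInc _∙_ e
proposition4p3p1 = Presentation.isPresentation
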